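{- Let $n\ge 2k>1$ and let $\mathcal F\subset\binom{[n]}{k}$ with $|\mathcal F|>\binom{n-1}{k-1}$. Then $$d(\mathcal F)\ge\max\Big\{\frac12,\,1-c(1)\Big\}\cdot\Big(1-\frac{c(2)k^2}{c(1)n}\Big)|\mathcal F|.$$
   Context: For $\mathcal F\subset\binom{[n]}{k}$, $d(\mathcal F)=\max_{F\in\mathcal F}|\{G\in\mathcal F:G\cap F=\emptyset\}|$. For $P\subset[n]$, $\mathcal F(P)=\{F\setminus P:P\subset F\in\mathcal F\}$. For $1\le i<k$, $c(i)=c(i,\mathcal F)=\binom{n-i}{k-i}^{ -1}\max\{|\mathcal F(P)|:P\in\binom{[n]}{i}\}$. -}

module Defs where

open import Data.Nat as ℕ using (ℕ; zero; suc; _∸_; _⊔_)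
open import Data.Nat.Combinatorics using (_C_)
open import Data.Integer using (+_)
open import Data.Rational as ℚ using (ℚ; _/_; _÷_; 0ℚ)
open import Data.Rational.Properties using (_≟_)
open import Data.List using (List; []; _∷_; length; filter; map; _++_; foldr)
open import Data.Fin.Subset using (Subset; _∩_; _⊆_; Nonempty; ∣_∣; inside; outside)
open import Data.Fin.Subset.Properties using (_⊆?_; nonempty?)
open import Data.Vec using ([]; _∷_)
open import Relation.Nullary using (¬_; ¬?; yes; no)
open import Relation.Nullary.Decidable using (does)
open import Data.Bool using (if_then_else_)

-- A family 𝓕 ⊂ ([n] choose k) is represented by a list of subsets of Fin n;
-- the hypotheses (distinct members, all of size k) are stated separately.
Family : ℕ → Set
Family n = List (Subset n)

maxℕ : List ℕ → ℕ
maxℕ = foldr _⊔_ 0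

Disjoint : ∀ {n} → Subset n → Subset n → Set
Disjoint F G = ¬ Nonempty (F ∩ G)

disjointCount : ∀ {n} → Family n → Subset n → ℕ
disjointCount 𝓕 F = length (filter (λ G → ¬? (nonempty? (F ∩ G))) 𝓕)

d : ∀ {n} → Family n → ℕ
d 𝓕 = maxℕ (map (disjointCount 𝓕) 𝓕)

linkSize : ∀ {n} → Family n → Subset n → ℕ
linkSize 𝓕 P = length (filter (λ F → P ⊆? F) 𝓕)

allSubsets : (n : ℕ) → List (Subset n)
allSubsets zero = [] ∷ []
allSubsets (suc n) = map (inside ∷_) (allSubsets n) ++ map (outside ∷_) (allSubsets n)

subsetsOfSize : (n i : ℕ) → List (Subset n)
subsetsOfSize n i = filter (λ P → ∣ P ∣ ℕ.≟ i) (allSubsets n)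

-- m / b as a rational (0 if b = 0; never used with b = 0 under our hypotheses)
frac : ℕ → ℕ → ℚ
frac m zero = 0ℚ
frac m (suc b) = (+ m) / suc b

-- division of rationals, 0 when the divisor is 0 (never used with divisor 0 here)
_÷'_ : ℚ → ℚ → ℚ
p ÷' q with q ≟ 0ℚ
... | yes _ = 0ℚ
... | no q≢0 = _÷_ p q {{ℚ.≢-nonZero q≢0}}

c : (n k i : ℕ) → Family n → ℚ
c n k i 𝓕 = frac (maxℕ (map (linkSize 𝓕) (subsetsOfSize n i))) ((n ∸ i) C (k ∸ i))

ℕtoℚ : ℕ → ℚ
ℕtoℚ m = (+ m) / 1

module Submission where

-- Let x be a vertex of maximum degree, so |𝓕(x)| = c(1)·C(n-1,k-1), and let 𝓑 be the members of 𝓕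
-- avoiding x; 𝓑 is nonempty since |𝓕| > C(n-1,k-1) ≥ |𝓕(x)|.  For each of its k points y, a member
-- A ∈ 𝓑 meets at most |𝓕({x,y})| ≤ M₂ = c(2)·C(n-2,k-2) members of 𝓕(x) and is disjoint from the
-- others, so |𝓕(x)| ≤ d(𝓕) + k·M₂.  Dually, each A ∈ 𝓕(x) is disjoint from at most d(𝓕) members of 𝓑,
-- and summing |A ∩ G| over the pairs (A, G) ∈ 𝓕(x) × 𝓑 from the side of G gives
-- |𝓕(x)|·|𝓑| ≤ |𝓕(x)|·d(𝓕) + |𝓑|·k·M₂.  With ε = c(2)k²/(c(1)n), the inequality
-- n·C(n-2,k-2) ≤ k·C(n-1,k-1) gives k·M₂ ≤ ε·|𝓕(x)|, hence (1-ε)|𝓕(x)| ≤ d(𝓕) and (1-ε)|𝓑| ≤ d(𝓕).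
-- Averaging these yields the factor ½, and |𝓑| ≥ (1 - c(1))|𝓕| the factor 1 - c(1).

module Arithmetic where
  open import Defs using (ℕtoℚ; frac; _÷'_)
  open import Data.Nat as ℕ using (ℕ; suc)
  import Data.Nat.Properties as ℕ
  open import Data.Integer as ℤ using (+_)
  import Data.Integer.Properties as ℤ
  import Data.Integer.Tactic.RingSolver as ℤ-Solver
  open import Data.Rational
  open import Data.Rational.Properties
  open import Data.Rational.Unnormalised as ℚᵘ using (ℚᵘ; mkℚᵘ; *≡*; *≤*) renaming (_≃_ to _≃ᵘ_)
  import Data.Rational.Unnormalised.Properties as ℚᵘ
  open import Data.Sum using (inj₁; inj₂)
  open import Level using (0ℓ)
  open import Relation.Binary.PropositionalEquality
  open import Relation.Nullary using (yes; no)
  open import Relation.Nullary.Decidable using (dec⇒maybe)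
  open import Tactic.RingSolver using (solve-∀)
  open import Tactic.RingSolver.Core.AlmostCommutativeRing using (AlmostCommutativeRing; fromCommutativeRing)

  ℚ-ring : AlmostCommutativeRing 0ℓ 0ℓ
  ℚ-ring = fromCommutativeRing +-*-commutativeRing (λ x → dec⇒maybe (0ℚ ≟ x))

  ℕtoℚᵘ : ℕ → ℚᵘ
  ℕtoℚᵘ m = mkℚᵘ (+ m) 0

  toℚᵘ-ℕtoℚ : ∀ m → toℚᵘ (ℕtoℚ m) ≃ᵘ ℕtoℚᵘ m
  toℚᵘ-ℕtoℚ m = toℚᵘ-fromℚᵘ (ℕtoℚᵘ m)

  ℕtoℚ-+ : ∀ m n → ℕtoℚ (m ℕ.+ n) ≡ ℕtoℚ m + ℕtoℚ n
  ℕtoℚ-+ m n = toℚᵘ-injective (begin-equality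
    toℚᵘ (ℕtoℚ (m ℕ.+ n))            ≃⟨ toℚᵘ-ℕtoℚ (m ℕ.+ n) ⟩
    ℕtoℚᵘ (m ℕ.+ n)                  ≃⟨ *≡* (trans (cong (ℤ._* + 1) (ℤ.pos-+ m n)) (cross-multiplied (+ m) (+ n))) ⟩
    ℕtoℚᵘ m ℚᵘ.+ ℕtoℚᵘ n              ≃⟨ ℚᵘ.+-cong (toℚᵘ-ℕtoℚ m) (toℚᵘ-ℕtoℚ n) ⟨
    toℚᵘ (ℕtoℚ m) ℚᵘ.+ toℚᵘ (ℕtoℚ n) ≃⟨ toℚᵘ-homo-+ (ℕtoℚ m) (ℕtoℚ n) ⟨
    toℚᵘ (ℕtoℚ m + ℕtoℚ n)          ∎)
    where
    open ℚᵘ.≤-Reasoning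
    cross-multiplied : ∀ x y → (x ℤ.+ y) ℤ.* + 1 ≡ (x ℤ.* + 1 ℤ.+ y ℤ.* + 1) ℤ.* (+ 1 ℤ.* + 1)
    cross-multiplied = ℤ-Solver.solve-∀

  ℕtoℚ-* : ∀ m n → ℕtoℚ (m ℕ.* n) ≡ ℕtoℚ m * ℕtoℚ n
  ℕtoℚ-* m n = toℚᵘ-injective (begin-equality
    toℚᵘ (ℕtoℚ (m ℕ.* n))            ≃⟨ toℚᵘ-ℕtoℚ (m ℕ.* n) ⟩
    ℕtoℚᵘ (m ℕ.* n)                  ≃⟨ *≡* (trans (cong (ℤ._* + 1) (ℤ.pos-* m n)) (cross-multiplied (+ m) (+ n))) ⟩
    ℕtoℚᵘ m ℚᵘ.* ℕtoℚᵘ n              ≃⟨ ℚᵘ.*-cong (toℚᵘ-ℕtoℚ m) (toℚᵘ-ℕtoℚ n) ⟨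
    toℚᵘ (ℕtoℚ m) ℚᵘ.* toℚᵘ (ℕtoℚ n) ≃⟨ toℚᵘ-homo-* (ℕtoℚ m) (ℕtoℚ n) ⟨
    toℚᵘ (ℕtoℚ m * ℕtoℚ n)          ∎)
    where
    open ℚᵘ.≤-Reasoning
    cross-multiplied : ∀ x y → (x ℤ.* y) ℤ.* + 1 ≡ (x ℤ.* y) ℤ.* (+ 1 ℤ.* + 1)
    cross-multiplied = ℤ-Solver.solve-∀

  ℕtoℚ-mono-≤ : ∀ {m n} → m ℕ.≤ n → ℕtoℚ m ≤ ℕtoℚ n
  ℕtoℚ-mono-≤ {m} {n} m≤n = toℚᵘ-cancel-≤ (begin
    toℚᵘ (ℕtoℚ m) ≃⟨ toℚᵘ-ℕtoℚ m ⟩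
    ℕtoℚᵘ m       ≤⟨ *≤* (ℤ.*-monoʳ-≤-nonNeg (+ 1) (ℤ.+≤+ m≤n)) ⟩
    ℕtoℚᵘ n       ≃⟨ toℚᵘ-ℕtoℚ n ⟨
    toℚᵘ (ℕtoℚ n) ∎)
    where open ℚᵘ.≤-Reasoning

  ℕtoℚ-nonNeg : ∀ m → NonNegative (ℕtoℚ m)
  ℕtoℚ-nonNeg m = normalize-nonNeg m 1

  ℕtoℚ-pos : ∀ m .{{_ : ℕ.NonZero m}} → Positive (ℕtoℚ m)
  ℕtoℚ-pos m = normalize-pos m 1

  frac-nonNeg : ∀ m b .{{_ : ℕ.NonZero b}} → NonNegative (frac m b)
  frac-nonNeg m (suc b) = normalize-nonNeg m (suc b)

  frac-pos : ∀ m b .{{_ : ℕ.NonZero m}} .{{_ : ℕ.NonZero b}} → Positive (frac m b)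
  frac-pos m (suc b) = normalize-pos m (suc b)

  frac-* : ∀ m b .{{_ : ℕ.NonZero b}} → frac m b * ℕtoℚ b ≡ ℕtoℚ m
  frac-* m (suc b) = toℚᵘ-injective (begin-equality
    toℚᵘ (frac m (suc b) * ℕtoℚ (suc b))              ≃⟨ toℚᵘ-homo-* (frac m (suc b)) (ℕtoℚ (suc b)) ⟩
    toℚᵘ (frac m (suc b)) ℚᵘ.* toℚᵘ (ℕtoℚ (suc b))    ≃⟨ ℚᵘ.*-cong (toℚᵘ-fromℚᵘ (mkℚᵘ (+ m) b)) (toℚᵘ-ℕtoℚ (suc b)) ⟩
    mkℚᵘ (+ m) b ℚᵘ.* ℕtoℚᵘ (suc b)                   ≃⟨ *≡* (trans (ℤ.*-identityʳ _) (cong ((+ m) ℤ.*_) (cong +_ (sym (ℕ.*-identityʳ (suc b)))))) ⟩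
    ℕtoℚᵘ m                                           ≃⟨ toℚᵘ-ℕtoℚ m ⟨
    toℚᵘ (ℕtoℚ m)                                     ∎)
    where open ℚᵘ.≤-Reasoning

  ÷'-* : ∀ p q .{{_ : NonZero q}} → (p ÷' q) * q ≡ p
  ÷'-* p q with q ≟ 0ℚ
  ÷'-* p _ {{()}} | yes refl
  ... | no q≢0 = trans (*-assoc p _ q) (trans (cong (p *_) (*-inverseˡ q {{≢-nonZero q≢0}})) (*-identityʳ p))

  S≤εA∧A≤D+S⇒A[1-ε]≤D : ∀ {A D S ε} → S ≤ ε * A → A ≤ D + S → A * (1ℚ - ε) ≤ D
  S≤εA∧A≤D+S⇒A[1-ε]≤D {A} {D} {S} {ε} S≤εA A≤D+S = begin
    A * (1ℚ - ε) ≡⟨ expand A ε ⟩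
    A - ε * A    ≤⟨ +-monoʳ-≤ A (neg-antimono-≤ S≤εA) ⟩
    A - S        ≤⟨ +-monoˡ-≤ (- S) A≤D+S ⟩
    D + S - S    ≡⟨ cancel D S ⟩
    D            ∎
    where
    open ≤-Reasoning
    expand : ∀ a e → a * (1ℚ - e) ≡ a - e * a
    expand = solve-∀ ℚ-ring
    cancel : ∀ d s → d + s - s ≡ d
    cancel = solve-∀ ℚ-ring

  ε-lower-bound : ∀ {A B₁ B₂ c₁ c₂ ε K M n S} .{{_ : Positive (n * B₂)}} →
    c₁ * B₁ ≡ A → c₂ * B₂ ≡ M → ε * (c₁ * n) ≡ c₂ * K →
    S * (n * B₂) ≤ M * K * B₁ → S ≤ ε * A
  ε-lower-bound {A} {B₁} {B₂} {c₁} {c₂} {ε} {K} {M} {n} {S} c₁B₁≡A c₂B₂≡M εc₁n≡c₂K SnB₂≤MKB₁ =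
    *-cancelʳ-≤-pos (n * B₂) (begin
      S * (n * B₂)            ≤⟨ SnB₂≤MKB₁ ⟩
      M * K * B₁              ≡⟨ cong (λ z → z * K * B₁) c₂B₂≡M ⟨
      c₂ * B₂ * K * B₁        ≡⟨ shuffle₁ c₂ B₂ K B₁ ⟩
      c₂ * K * (B₁ * B₂)      ≡⟨ cong (_* (B₁ * B₂)) εc₁n≡c₂K ⟨
      ε * (c₁ * n) * (B₁ * B₂) ≡⟨ shuffle₂ ε c₁ n B₁ B₂ ⟩
      ε * (c₁ * B₁) * (n * B₂) ≡⟨ cong (λ z → ε * z * (n * B₂)) c₁B₁≡A ⟩
      ε * A * (n * B₂)        ∎)
    where
    open ≤-Reasoning
    shuffle₁ : ∀ c b k b₁ → c * b * k * b₁ ≡ c * k * (b₁ * b)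
    shuffle₁ = solve-∀ ℚ-ring
    shuffle₂ : ∀ e c m b₁ b₂ → e * (c * m) * (b₁ * b₂) ≡ e * (c * b₁) * (m * b₂)
    shuffle₂ = solve-∀ ℚ-ring

  ½⊔[1-c]-bound : ∀ {A B D N c t} .{{_ : NonNegative N}} .{{_ : NonNegative D}} →
    N ≡ A + B → A ≤ c * N → A * t ≤ D → B * t ≤ D → (½ ⊔ (1ℚ - c)) * t * N ≤ D
  ½⊔[1-c]-bound {A} {B} {D} {N} {c} {t} N≡A+B A≤cN At≤D Bt≤D with ≤-total t 0ℚ
  ... | inj₁ t≤0 = ≤-trans (nonPositive⁻¹ (m * t * N) {{mtN≤0}}) (nonNegative⁻¹ D)
    where
    m : ℚ
    m = ½ ⊔ (1ℚ - c)
    instance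
      m≥0 : NonNegative m
      m≥0 = nonNegative (≤-trans (nonNegative⁻¹ ½) (p≤p⊔q ½ (1ℚ - c)))
      t≤0' : NonPositive t
      t≤0' = nonPositive t≤0
      mt≤0 : NonPositive (m * t)
      mt≤0 = nonNeg*nonPos⇒nonPos m t
    mtN≤0 : NonPositive (m * t * N)
    mtN≤0 = nonPos*nonNeg⇒nonPos (m * t) N
  ... | inj₂ t≥0 = begin
    (½ ⊔ (1ℚ - c)) * t * N         ≡⟨ cong (_* N) (*-distribʳ-⊔-nonNeg t ½ (1ℚ - c)) ⟩
    (½ * t ⊔ (1ℚ - c) * t) * N     ≡⟨ *-distribʳ-⊔-nonNeg N (½ * t) ((1ℚ - c) * t) ⟩
    ½ * t * N ⊔ (1ℚ - c) * t * N   ≤⟨ ⊔-lub ½tN≤D [1-c]tN≤D ⟩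
    D                              ∎
    where
    open ≤-Reasoning
    instance
      t-nonNeg : NonNegative t
      t-nonNeg = nonNegative t≥0
    ½tN≤D : ½ * t * N ≤ D
    ½tN≤D = begin
      ½ * t * N           ≡⟨ cong (½ * t *_) N≡A+B ⟩
      ½ * t * (A + B)     ≡⟨ regroup ½ t A B ⟩
      ½ * (A * t + B * t) ≤⟨ *-monoˡ-≤-nonNeg ½ (+-mono-≤ At≤D Bt≤D) ⟩
      ½ * (D + D)         ≡⟨ halve D ⟩
      (½ + ½) * D         ≡⟨ *-identityˡ D ⟩
      D                   ∎
      where
      regroup : ∀ h x a b → h * x * (a + b) ≡ h * (a * x + b * x)
      regroup = solve-∀ ℚ-ring
      halve : ∀ d → ½ * (d + d) ≡ (½ + ½) * d
      halve = solve-∀ ℚ-ring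
    [1-c]N≤B : (1ℚ - c) * N ≤ B
    [1-c]N≤B = begin
      (1ℚ - c) * N ≡⟨ expand c N ⟩
      N - c * N    ≤⟨ +-monoʳ-≤ N (neg-antimono-≤ A≤cN) ⟩
      N - A        ≡⟨ cong (_- A) N≡A+B ⟩
      A + B - A    ≡⟨ cancel A B ⟩
      B            ∎
      where
      expand : ∀ x y → (1ℚ - x) * y ≡ y - x * y
      expand = solve-∀ ℚ-ring
      cancel : ∀ a b → a + b - a ≡ b
      cancel = solve-∀ ℚ-ring
    [1-c]tN≤D : (1ℚ - c) * t * N ≤ D
    [1-c]tN≤D = begin
      (1ℚ - c) * t * N   ≡⟨ swap (1ℚ - c) t N ⟩
      t * ((1ℚ - c) * N) ≤⟨ *-monoˡ-≤-nonNeg t [1-c]N≤B ⟩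
      t * B              ≡⟨ *-comm t B ⟩
      B * t              ≤⟨ Bt≤D ⟩
      D                  ∎
      where
      swap : ∀ x y z → x * y * z ≡ y * (x * z)
      swap = solve-∀ ℚ-ring

  -- In the application a = |𝓕(x)| for a vertex x of maximum degree, b is the number of members
  -- avoiding x, M₂ = max |𝓕(P)| over pairs P, B₁ = C(n-1,k-1) and B₂ = C(n-2,k-2).
  bound-from-counts : ∀ n k {N a b d M₂ B₁ B₂} →
    .{{_ : ℕ.NonZero n}} .{{_ : ℕ.NonZero a}} .{{_ : ℕ.NonZero B₁}} .{{_ : ℕ.NonZero B₂}} →
    a ℕ.+ b ≡ N → B₁ ℕ.≤ N →
    a ℕ.≤ d ℕ.+ k ℕ.* M₂ → a ℕ.* b ℕ.≤ a ℕ.* d ℕ.+ b ℕ.* (k ℕ.* M₂) →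
    k ℕ.* M₂ ℕ.* (n ℕ.* B₂) ℕ.≤ M₂ ℕ.* (k ℕ.* k) ℕ.* B₁ →
    (½ ⊔ (1ℚ - frac a B₁)) * (1ℚ - ((frac M₂ B₂ * ℕtoℚ (k ℕ.* k)) ÷' (frac a B₁ * ℕtoℚ n))) * ℕtoℚ N
      ≤ ℕtoℚ d
  bound-from-counts n k {N} {a} {b} {d} {M₂} {B₁} {B₂} a+b≡N B₁≤N a≤d+s ab≤ad+bs snB₂≤M₂kkB₁ =
    ½⊔[1-c]-bound {c = c₁} {t = 1ℚ - ε} N≡A+B A≤c₁N (S≤εA∧A≤D+S⇒A[1-ε]≤D {ε = ε} S≤εA A≤D+S) B[1-ε]≤D
    where
    open ≤-Reasoning
    A B D S c₁ ε : ℚ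
    A = ℕtoℚ a
    B = ℕtoℚ b
    D = ℕtoℚ d
    S = ℕtoℚ (k ℕ.* M₂)
    c₁ = frac a B₁
    ε = (frac M₂ B₂ * ℕtoℚ (k ℕ.* k)) ÷' (c₁ * ℕtoℚ n)
    instance
      N-nonNeg : NonNegative (ℕtoℚ N)
      N-nonNeg = ℕtoℚ-nonNeg N
      D-nonNeg : NonNegative D
      D-nonNeg = ℕtoℚ-nonNeg d
      B-nonNeg : NonNegative B
      B-nonNeg = ℕtoℚ-nonNeg b
      A-pos : Positive A
      A-pos = ℕtoℚ-pos a
      c₁-nonNeg : NonNegative c₁
      c₁-nonNeg = frac-nonNeg a B₁
      c₁n-nonZero : NonZero (c₁ * ℕtoℚ n)
      c₁n-nonZero = pos⇒nonZero (c₁ * ℕtoℚ n) {{pos*pos⇒pos c₁ {{frac-pos a B₁}} (ℕtoℚ n) {{ℕtoℚ-pos n}}}}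
      nB₂-pos : Positive (ℕtoℚ n * ℕtoℚ B₂)
      nB₂-pos = pos*pos⇒pos (ℕtoℚ n) {{ℕtoℚ-pos n}} (ℕtoℚ B₂) {{ℕtoℚ-pos B₂}}
    N≡A+B : ℕtoℚ N ≡ A + B
    N≡A+B = trans (cong ℕtoℚ (sym a+b≡N)) (ℕtoℚ-+ a b)
    A≤c₁N : A ≤ c₁ * ℕtoℚ N
    A≤c₁N = begin
      A               ≡⟨ frac-* a B₁ ⟨
      c₁ * ℕtoℚ B₁    ≤⟨ *-monoˡ-≤-nonNeg c₁ (ℕtoℚ-mono-≤ B₁≤N) ⟩
      c₁ * ℕtoℚ N     ∎
    S≤εA : S ≤ ε * A
    S≤εA = ε-lower-bound {c₁ = c₁} {c₂ = frac M₂ B₂} {ε = ε} (frac-* a B₁) (frac-* M₂ B₂) (÷'-* _ (c₁ * ℕtoℚ n)) (begin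
      S * (ℕtoℚ n * ℕtoℚ B₂)                  ≡⟨ cong (S *_) (ℕtoℚ-* n B₂) ⟨
      S * ℕtoℚ (n ℕ.* B₂)                     ≡⟨ ℕtoℚ-* (k ℕ.* M₂) (n ℕ.* B₂) ⟨
      ℕtoℚ (k ℕ.* M₂ ℕ.* (n ℕ.* B₂))          ≤⟨ ℕtoℚ-mono-≤ snB₂≤M₂kkB₁ ⟩
      ℕtoℚ (M₂ ℕ.* (k ℕ.* k) ℕ.* B₁)          ≡⟨ ℕtoℚ-* (M₂ ℕ.* (k ℕ.* k)) B₁ ⟩
      ℕtoℚ (M₂ ℕ.* (k ℕ.* k)) * ℕtoℚ B₁       ≡⟨ cong (_* ℕtoℚ B₁) (ℕtoℚ-* M₂ (k ℕ.* k)) ⟩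
      ℕtoℚ M₂ * ℕtoℚ (k ℕ.* k) * ℕtoℚ B₁      ∎)
    A≤D+S : A ≤ D + S
    A≤D+S = begin
      A                  ≤⟨ ℕtoℚ-mono-≤ a≤d+s ⟩
      ℕtoℚ (d ℕ.+ k ℕ.* M₂) ≡⟨ ℕtoℚ-+ d (k ℕ.* M₂) ⟩
      D + S              ∎
    B[1-ε]≤D : B * (1ℚ - ε) ≤ D
    B[1-ε]≤D = *-cancelˡ-≤-pos A (begin
      A * (B * (1ℚ - ε)) ≡⟨ *-assoc A B (1ℚ - ε) ⟨
      A * B * (1ℚ - ε)   ≤⟨ S≤εA∧A≤D+S⇒A[1-ε]≤D {ε = ε} BS≤εAB AB≤AD+BS ⟩
      A * D              ∎)
      where
      BS≤εAB : B * S ≤ ε * (A * B)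
      BS≤εAB = begin
        B * S       ≤⟨ *-monoˡ-≤-nonNeg B S≤εA ⟩
        B * (ε * A) ≡⟨ rotate B ε A ⟩
        ε * (A * B) ∎
        where
        rotate : ∀ x y z → x * (y * z) ≡ y * (z * x)
        rotate = solve-∀ ℚ-ring
      AB≤AD+BS : A * B ≤ A * D + B * S
      AB≤AD+BS = begin
        A * B                               ≡⟨ ℕtoℚ-* a b ⟨
        ℕtoℚ (a ℕ.* b)                      ≤⟨ ℕtoℚ-mono-≤ ab≤ad+bs ⟩
        ℕtoℚ (a ℕ.* d ℕ.+ b ℕ.* (k ℕ.* M₂)) ≡⟨ ℕtoℚ-+ (a ℕ.* d) (b ℕ.* (k ℕ.* M₂)) ⟩
        ℕtoℚ (a ℕ.* d) + ℕtoℚ (b ℕ.* (k ℕ.* M₂)) ≡⟨ cong₂ _+_ (ℕtoℚ-* a d) (ℕtoℚ-* b (k ℕ.* M₂)) ⟩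
        A * D + B * S                       ∎

module Counting where
  open import Defs
  open import Data.Nat
  open import Data.Nat.Properties
  open import Data.Nat.ListAction using (sum)
  open import Data.Nat.Combinatorics using (_C_; nCk+nC[k+1]≡[n+1]C[k+1]; nC1≡n)
  open import Data.Nat.Tactic.RingSolver using (solve-∀)
  open import Algebra.Properties.CommutativeSemigroup +-commutativeSemigroup using (interchange; x∙yz≈y∙xz)
  open import Data.List using (List; []; _∷_; length; filter; map)
  open import Data.List.Properties using (filter-none; filter-some; map-cong)
  open import Data.List.Membership.Propositional using () renaming (_∈_ to _∈ₗ_)
  open import Data.List.Membership.Propositional.Properties using (∈-filter⁺; ∈-filter⁻; ∈-map⁺; ∈-++⁺ˡ; ∈-++⁺ʳ)
  open import Data.List.Relation.Unary.Any using (here; there)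
  open import Data.Fin using (Fin; zero; suc)
  open import Data.Vec using ([]; _∷_; here; there; tail)
  open import Data.Fin.Subset using (Subset; _∈_; _∉_; _⊆_; ∣_∣; _∩_; _∪_; ⁅_⁆; inside; outside) renaming (⊥ to ∅)
  open import Data.Fin.Subset.Properties using (_∈?_; _⊆?_; nonempty?; x∈p⇒∣p-x∣<∣p∣; ∣⁅x⁆∣≡1; ∪-identityˡ; ∪-identityʳ; x∈p∪q⁻; x∈⁅y⁆⇒x≡y; x∈⁅x⁆; drop-there; p⊆q⇒∣p∣≤∣q∣; ∩-comm)
  open import Data.Product using (∃-syntax; _×_; _,_; proj₁; proj₂)
  open import Data.Sum using (inj₁; inj₂)
  open import Data.Empty using (⊥; ⊥-elim)
  open import Data.List.Relation.Unary.All as All using (All; []; _∷_)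
  import Data.List.Relation.Unary.All.Properties as All
  import Data.List.Relation.Unary.Unique.Propositional.Properties as Unique
  open import Data.List.Relation.Unary.Unique.Propositional using (Unique)
  open import Data.List.Relation.Unary.AllPairs using ([]; _∷_)
  open import Function using (_∘_; id)
  open import Level using (0ℓ)
  open import Relation.Binary.PropositionalEquality
  open import Relation.Nullary using (yes; no; ¬_; ¬?)
  open import Relation.Unary using (Pred; Decidable)
  open import Relation.Unary.Properties using (∁?)

  private variable
    T : Set
    n : ℕ

  sum-map-mono : ∀ {f g : T → ℕ} xs → (∀ {x} → x ∈ₗ xs → f x ≤ g x) → sum (map f xs) ≤ sum (map g xs)
  sum-map-mono []       f≤g = z≤n
  sum-map-mono (x ∷ xs) f≤g = +-mono-≤ (f≤g (here refl)) (sum-map-mono xs (f≤g ∘ there))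

  sum-map-const : ∀ c (xs : List T) → sum (map (λ _ → c) xs) ≡ length xs * c
  sum-map-const c []       = refl
  sum-map-const c (x ∷ xs) = cong (c +_) (sum-map-const c xs)

  sum-map-+ : ∀ (f g : T → ℕ) xs → sum (map (λ x → f x + g x) xs) ≡ sum (map f xs) + sum (map g xs)
  sum-map-+ f g []       = refl
  sum-map-+ f g (x ∷ xs) = trans (cong (f x + g x +_) (sum-map-+ f g xs)) (interchange (f x) (g x) _ _)

  sum-map-swap : ∀ {B : Set} (f : T → B → ℕ) xs ys →
    sum (map (λ x → sum (map (f x) ys)) xs) ≡ sum (map (λ y → sum (map (λ x → f x y) xs)) ys)
  sum-map-swap f []       ys = sym (trans (sum-map-const 0 ys) (*-zeroʳ (length ys)))
  sum-map-swap f (x ∷ xs) ys =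
    trans (cong (sum (map (f x) ys) +_) (sum-map-swap f xs ys)) (sym (sum-map-+ (f x) _ ys))

  module _ {P : Pred T 0ℓ} (P? : Decidable P) where

    length-filter+length-filter-∁ : ∀ xs → length (filter P? xs) + length (filter (∁? P?) xs) ≡ length xs
    length-filter+length-filter-∁ []       = refl
    length-filter+length-filter-∁ (x ∷ xs) with P? x
    ... | yes _ = cong suc (length-filter+length-filter-∁ xs)
    ... | no  _ = trans (+-suc _ _) (cong suc (length-filter+length-filter-∁ xs))

    module _ {Q R : Pred T 0ℓ} (Q? : Decidable Q) (R? : Decidable R) (P∧Q⇒R : ∀ {x} → P x → Q x → R x) where

      length-filter-filter≤ : ∀ xs → length (filter Q? (filter P? xs)) ≤ length (filter R? xs)
      length-filter-filter≤ []       = z≤n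
      length-filter-filter≤ (x ∷ xs) with P? x
      ... | no _ with R? x
      ...   | yes _ = m≤n⇒m≤1+n (length-filter-filter≤ xs)
      ...   | no _  = length-filter-filter≤ xs
      length-filter-filter≤ (x ∷ xs) | yes p with Q? x | R? x
      ...   | no _  | yes _ = m≤n⇒m≤1+n (length-filter-filter≤ xs)
      ...   | no _  | no _  = length-filter-filter≤ xs
      ...   | yes _ | yes _ = s≤s (length-filter-filter≤ xs)
      ...   | yes q | no ¬r = ⊥-elim (¬r (P∧Q⇒R p q))

  maxℕ-bound : ∀ (f : T → ℕ) {x} xs → x ∈ₗ xs → f x ≤ maxℕ (map f xs)
  maxℕ-bound f (x ∷ xs) (here refl) = m≤m⊔n (f x) _
  maxℕ-bound f (x ∷ xs) (there x∈)  = ≤-trans (maxℕ-bound f xs x∈) (m≤n⊔m (f x) _)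

  maxℕ-lub : ∀ (f : T → ℕ) {m} xs → (∀ {x} → x ∈ₗ xs → f x ≤ m) → maxℕ (map f xs) ≤ m
  maxℕ-lub f []       _    = z≤n
  maxℕ-lub f (x ∷ xs) f≤m = ⊔-lub (f≤m (here refl)) (maxℕ-lub f xs (f≤m ∘ there))

  maxℕ-attained : ∀ (f : T → ℕ) xs → 0 < maxℕ (map f xs) → ∃[ x ] x ∈ₗ xs × f x ≡ maxℕ (map f xs)
  maxℕ-attained f (x ∷ xs) max>0 with ⊔-sel (f x) (maxℕ (map f xs))
  ... | inj₁ max≡fx = x , here refl , sym max≡fx
  ... | inj₂ max≡rest with maxℕ-attained f xs (subst (0 <_) max≡rest max>0)
  ...   | y , y∈ , fy≡ = y , there y∈ , trans fy≡ (sym max≡rest)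

  x∈p⇒0<∣p∣ : ∀ {x : Fin n} {p} → x ∈ p → 0 < ∣ p ∣
  x∈p⇒0<∣p∣ x∈p = ≤-trans (s≤s z≤n) (x∈p⇒∣p-x∣<∣p∣ x∈p)

  0<∣p∣⇒∃∈ : ∀ (p : Subset n) → 0 < ∣ p ∣ → ∃[ x ] x ∈ p
  0<∣p∣⇒∃∈ (inside  ∷ p) _ = zero , here
  0<∣p∣⇒∃∈ (outside ∷ p) ∣p∣>0 with 0<∣p∣⇒∃∈ p ∣p∣>0
  ... | x , x∈p = suc x , there x∈p

  ∣p∣≡0⇒p≡∅ : ∀ (p : Subset n) → ∣ p ∣ ≡ 0 → p ≡ ∅
  ∣p∣≡0⇒p≡∅ []            _      = refl
  ∣p∣≡0⇒p≡∅ (outside ∷ p) ∣p∣≡0 = cong (outside ∷_) (∣p∣≡0⇒p≡∅ p ∣p∣≡0)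

  ∣p∣≡1⇒p≡⁅x⁆ : ∀ (p : Subset n) → ∣ p ∣ ≡ 1 → ∃[ x ] p ≡ ⁅ x ⁆
  ∣p∣≡1⇒p≡⁅x⁆ (inside  ∷ p) ∣p∣≡1 = zero , cong (inside ∷_) (∣p∣≡0⇒p≡∅ p (suc-injective ∣p∣≡1))
  ∣p∣≡1⇒p≡⁅x⁆ (outside ∷ p) ∣p∣≡1 with ∣p∣≡1⇒p≡⁅x⁆ p ∣p∣≡1
  ... | x , refl = suc x , refl

  ∣⁅x⁆∪⁅y⁆∣≡2 : ∀ {x y : Fin n} → x ≢ y → ∣ ⁅ x ⁆ ∪ ⁅ y ⁆ ∣ ≡ 2
  ∣⁅x⁆∪⁅y⁆∣≡2 {x = zero}  {zero}  x≢y = ⊥-elim (x≢y refl)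
  ∣⁅x⁆∪⁅y⁆∣≡2 {x = zero}  {suc y} _   = cong suc (trans (cong ∣_∣ (∪-identityˡ ⁅ y ⁆)) (∣⁅x⁆∣≡1 y))
  ∣⁅x⁆∪⁅y⁆∣≡2 {x = suc x} {zero}  _   = cong suc (trans (cong ∣_∣ (∪-identityʳ ⁅ x ⁆)) (∣⁅x⁆∣≡1 x))
  ∣⁅x⁆∪⁅y⁆∣≡2 {x = suc x} {suc y} x≢y = ∣⁅x⁆∪⁅y⁆∣≡2 (x≢y ∘ cong suc)

  x∈p⇒⁅x⁆⊆p : ∀ {x : Fin n} {p} → x ∈ p → ⁅ x ⁆ ⊆ p
  x∈p⇒⁅x⁆⊆p {x = x} x∈p y∈⁅x⁆ = subst (_∈ _) (sym (x∈⁅y⁆⇒x≡y x y∈⁅x⁆)) x∈p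

  ⁅x⁆∪⁅y⁆⊆p : ∀ {x y : Fin n} {p} → x ∈ p → y ∈ p → ⁅ x ⁆ ∪ ⁅ y ⁆ ⊆ p
  ⁅x⁆∪⁅y⁆⊆p {x = x} {y} x∈p y∈p z∈ with x∈p∪q⁻ ⁅ x ⁆ ⁅ y ⁆ z∈
  ... | inj₁ z∈⁅x⁆ = x∈p⇒⁅x⁆⊆p x∈p z∈⁅x⁆
  ... | inj₂ z∈⁅y⁆ = x∈p⇒⁅x⁆⊆p y∈p z∈⁅y⁆

  ∈-allSubsets : ∀ (p : Subset n) → p ∈ₗ allSubsets n
  ∈-allSubsets []            = here refl
  ∈-allSubsets (inside  ∷ p) = ∈-++⁺ˡ (∈-map⁺ (inside ∷_) (∈-allSubsets p))
  ∈-allSubsets (outside ∷ p) = ∈-++⁺ʳ _ (∈-map⁺ (outside ∷_) (∈-allSubsets p))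

  ∈-subsetsOfSize⁺ : ∀ {p : Subset n} {i} → ∣ p ∣ ≡ i → p ∈ₗ subsetsOfSize n i
  ∈-subsetsOfSize⁺ {p = p} {i} ∣p∣≡i = ∈-filter⁺ (λ q → ∣ q ∣ ≟ i) (∈-allSubsets p) ∣p∣≡i

  ∈-subsetsOfSize⁻ : ∀ {p : Subset n} {i} → p ∈ₗ subsetsOfSize n i → ∣ p ∣ ≡ i
  ∈-subsetsOfSize⁻ {n = n} {i = i} p∈ = proj₂ (∈-filter⁻ (λ q → ∣ q ∣ ≟ i) {xs = allSubsets n} p∈)

  degree : Fin n → List (Subset n) → ℕ
  degree y 𝓖 = length (filter (y ∈?_) 𝓖)

  overlapSum : Subset n → List (Subset n) → ℕ
  overlapSum p 𝓖 = sum (map (λ G → ∣ p ∩ G ∣) 𝓖)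

  degree-suc : ∀ (y : Fin n) 𝓖 → degree (suc y) 𝓖 ≡ degree y (map tail 𝓖)
  degree-suc y []            = refl
  degree-suc y ((_ ∷ G) ∷ 𝓖) with y ∈? G
  ... | yes _ = cong suc (degree-suc y 𝓖)
  ... | no  _ = degree-suc y 𝓖

  overlapSum-[] : ∀ (𝓖 : List (Subset 0)) → overlapSum [] 𝓖 ≡ 0
  overlapSum-[] []       = refl
  overlapSum-[] ([] ∷ 𝓖) = overlapSum-[] 𝓖

  overlapSum-outside : ∀ (p : Subset n) 𝓖 → overlapSum (outside ∷ p) 𝓖 ≡ overlapSum p (map tail 𝓖)
  overlapSum-outside p []            = refl
  overlapSum-outside p ((_ ∷ G) ∷ 𝓖) = cong (∣ p ∩ G ∣ +_) (overlapSum-outside p 𝓖)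

  overlapSum-inside : ∀ (p : Subset n) 𝓖 → overlapSum (inside ∷ p) 𝓖 ≡ degree zero 𝓖 + overlapSum p (map tail 𝓖)
  overlapSum-inside p []                  = refl
  overlapSum-inside p ((outside ∷ G) ∷ 𝓖) =
    trans (cong (∣ p ∩ G ∣ +_) (overlapSum-inside p 𝓖)) (x∙yz≈y∙xz ∣ p ∩ G ∣ (degree zero 𝓖) _)
  overlapSum-inside p ((inside ∷ G) ∷ 𝓖)  =
    cong suc (trans (cong (∣ p ∩ G ∣ +_) (overlapSum-inside p 𝓖)) (x∙yz≈y∙xz ∣ p ∩ G ∣ (degree zero 𝓖) _))

  overlapSum≤∣p∣*maxDegree : ∀ (p : Subset n) 𝓖 {M} → (∀ {y} → y ∈ p → degree y 𝓖 ≤ M) → overlapSum p 𝓖 ≤ ∣ p ∣ * M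
  overlapSum≤∣p∣*maxDegree []            𝓖 _ = ≤-reflexive (overlapSum-[] 𝓖)
  overlapSum≤∣p∣*maxDegree (outside ∷ p) 𝓖 deg≤M rewrite overlapSum-outside p 𝓖 =
    overlapSum≤∣p∣*maxDegree p (map tail 𝓖) (λ {y} y∈p → subst (_≤ _) (degree-suc y 𝓖) (deg≤M (there y∈p)))
  overlapSum≤∣p∣*maxDegree (inside  ∷ p) 𝓖 deg≤M rewrite overlapSum-inside p 𝓖 =
    +-mono-≤ (deg≤M here)
      (overlapSum≤∣p∣*maxDegree p (map tail 𝓖) (λ {y} y∈p → subst (_≤ _) (degree-suc y 𝓖) (deg≤M (there y∈p))))

  length≤disjointCount+overlapSum : ∀ (p : Subset n) 𝓖 → length 𝓖 ≤ disjointCount 𝓖 p + overlapSum p 𝓖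
  length≤disjointCount+overlapSum p []       = z≤n
  length≤disjointCount+overlapSum p (G ∷ 𝓖) with nonempty? (p ∩ G)
  ... | yes (x , x∈p∩G) = begin
    suc (length 𝓖)                                         ≤⟨ +-mono-≤ (x∈p⇒0<∣p∣ x∈p∩G) (length≤disjointCount+overlapSum p 𝓖) ⟩
    ∣ p ∩ G ∣ + (disjointCount 𝓖 p + overlapSum p 𝓖)      ≡⟨ x∙yz≈y∙xz ∣ p ∩ G ∣ (disjointCount 𝓖 p) _ ⟩
    disjointCount 𝓖 p + (∣ p ∩ G ∣ + overlapSum p 𝓖)      ∎
    where open ≤-Reasoning
  ... | no _ = s≤s (≤-trans (length≤disjointCount+overlapSum p 𝓖) (+-monoʳ-≤ (disjointCount 𝓖 p) (m≤n+m _ ∣ p ∩ G ∣)))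

  headIn headOut : List (Subset (suc n)) → List (Subset n)
  headIn []                  = []
  headIn ((inside  ∷ G) ∷ 𝓖) = G ∷ headIn 𝓖
  headIn ((outside ∷ G) ∷ 𝓖) = headIn 𝓖
  headOut []                  = []
  headOut ((inside  ∷ G) ∷ 𝓖) = headOut 𝓖
  headOut ((outside ∷ G) ∷ 𝓖) = G ∷ headOut 𝓖

  length-headIn+headOut : ∀ (𝓖 : List (Subset (suc n))) → length 𝓖 ≡ length (headIn 𝓖) + length (headOut 𝓖)
  length-headIn+headOut []                  = refl
  length-headIn+headOut ((inside  ∷ G) ∷ 𝓖) = cong suc (length-headIn+headOut 𝓖)
  length-headIn+headOut ((outside ∷ G) ∷ 𝓖) = trans (cong suc (length-headIn+headOut 𝓖)) (sym (+-suc _ _))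

  module _ {P : Pred (Subset (suc n)) 0ℓ} {Q : Pred (Subset n) 0ℓ} where

    headIn⁺ : (∀ {G} → P (inside ∷ G) → Q G) → ∀ {𝓖} → All P 𝓖 → All Q (headIn 𝓖)
    headIn⁺ P⇒Q {[]}                  []       = []
    headIn⁺ P⇒Q {(inside  ∷ G) ∷ 𝓖} (p ∷ ps) = P⇒Q p ∷ headIn⁺ P⇒Q ps
    headIn⁺ P⇒Q {(outside ∷ G) ∷ 𝓖} (_ ∷ ps) = headIn⁺ P⇒Q ps

    headOut⁺ : (∀ {G} → P (outside ∷ G) → Q G) → ∀ {𝓖} → All P 𝓖 → All Q (headOut 𝓖)
    headOut⁺ P⇒Q {[]}                  []       = []
    headOut⁺ P⇒Q {(inside  ∷ G) ∷ 𝓖} (_ ∷ ps) = headOut⁺ P⇒Q ps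
    headOut⁺ P⇒Q {(outside ∷ G) ∷ 𝓖} (p ∷ ps) = P⇒Q p ∷ headOut⁺ P⇒Q ps

  headIn-unique : ∀ {𝓖 : List (Subset (suc n))} → Unique 𝓖 → Unique (headIn 𝓖)
  headIn-unique {𝓖 = []}                  []       = []
  headIn-unique {𝓖 = (inside  ∷ G) ∷ 𝓖} (G≢ ∷ u) = headIn⁺ (λ ≢ → ≢ ∘ cong (inside ∷_)) G≢ ∷ headIn-unique u
  headIn-unique {𝓖 = (outside ∷ G) ∷ 𝓖} (_ ∷ u)  = headIn-unique u

  headOut-unique : ∀ {𝓖 : List (Subset (suc n))} → Unique 𝓖 → Unique (headOut 𝓖)
  headOut-unique {𝓖 = []}                  []       = []
  headOut-unique {𝓖 = (inside  ∷ G) ∷ 𝓖} (_ ∷ u)  = headOut-unique u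
  headOut-unique {𝓖 = (outside ∷ G) ∷ 𝓖} (G≢ ∷ u) = headOut⁺ (λ ≢ → ≢ ∘ cong (outside ∷_)) G≢ ∷ headOut-unique u

  All⊥⇒length≡0 : ∀ {𝓖 : List T} → All (λ _ → ⊥) 𝓖 → length 𝓖 ≡ 0
  All⊥⇒length≡0 [] = refl

  uniqueSized-length≤C : ∀ n j {𝓖 : List (Subset n)} → Unique 𝓖 → All (λ G → ∣ G ∣ ≡ j) 𝓖 → length 𝓖 ≤ n C j
  uniqueSized-length≤C zero    zero    {[]}              _                 _        = z≤n
  uniqueSized-length≤C zero    zero    {[] ∷ []}         _                 _        = ≤-refl
  uniqueSized-length≤C zero    zero    {[] ∷ [] ∷ _}     ((≢ ∷ _) ∷ _)     _        = ⊥-elim (≢ refl)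
  uniqueSized-length≤C zero    (suc j) {[]}              _                 _        = z≤n
  uniqueSized-length≤C zero    (suc j) {[] ∷ _}          _                 (() ∷ _)
  uniqueSized-length≤C (suc n) zero    {𝓖}               u                 sized    = begin
    length 𝓖                               ≡⟨ length-headIn+headOut 𝓖 ⟩
    length (headIn 𝓖) + length (headOut 𝓖) ≡⟨ cong (_+ length (headOut 𝓖)) (All⊥⇒length≡0 (headIn⁺ (λ ()) sized)) ⟩
    length (headOut 𝓖)                     ≤⟨ uniqueSized-length≤C n zero (headOut-unique u) (headOut⁺ id sized) ⟩
    1                                       ∎
    where open ≤-Reasoning
  uniqueSized-length≤C (suc n) (suc j) {𝓖}               u                 sized    = begin
    length 𝓖                               ≡⟨ length-headIn+headOut 𝓖 ⟩
    length (headIn 𝓖) + length (headOut 𝓖) ≤⟨ +-mono-≤ (uniqueSized-length≤C n j (headIn-unique u) (headIn⁺ suc-injective sized))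
                                                        (uniqueSized-length≤C n (suc j) (headOut-unique u) (headOut⁺ id sized)) ⟩
    n C j + n C suc j                       ≡⟨ nCk+nC[k+1]≡[n+1]C[k+1] n j ⟩
    suc n C suc j                           ∎
    where open ≤-Reasoning

  star-length≤C : ∀ n (x : Fin (suc n)) j {𝓖 : List (Subset (suc n))} →
    Unique 𝓖 → All (λ G → ∣ G ∣ ≡ suc j) 𝓖 → All (x ∈_) 𝓖 → length 𝓖 ≤ n C j
  star-length≤C n zero j {𝓖} u sized ∋x = begin
    length 𝓖                               ≡⟨ length-headIn+headOut 𝓖 ⟩
    length (headIn 𝓖) + length (headOut 𝓖) ≡⟨ cong (length (headIn 𝓖) +_) (All⊥⇒length≡0 (headOut⁺ (λ ()) ∋x)) ⟩
    length (headIn 𝓖) + 0                  ≡⟨ +-identityʳ _ ⟩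
    length (headIn 𝓖)                      ≤⟨ uniqueSized-length≤C n j (headIn-unique u) (headIn⁺ suc-injective sized) ⟩
    n C j                                   ∎
    where open ≤-Reasoning
  star-length≤C (suc n) (suc x) zero {𝓖} u sized ∋x = begin
    length 𝓖                               ≡⟨ length-headIn+headOut 𝓖 ⟩
    length (headIn 𝓖) + length (headOut 𝓖) ≡⟨ cong (_+ length (headOut 𝓖)) (All⊥⇒length≡0 headIn-empty) ⟩
    length (headOut 𝓖)                     ≤⟨ star-length≤C n x zero (headOut-unique u) (headOut⁺ id sized) (headOut⁺ drop-there ∋x) ⟩
    1                                       ∎
    where
    open ≤-Reasoning
    headIn-empty : All (λ _ → ⊥) (headIn 𝓖)
    headIn-empty = headIn⁺ (λ (∣xG∣≡1 , x∈G) → n≮0 (subst (0 <_) (suc-injective ∣xG∣≡1) (x∈p⇒0<∣p∣ (drop-there x∈G))))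
                           (All.zip (sized , ∋x))
  star-length≤C (suc n) (suc x) (suc j) {𝓖} u sized ∋x = begin
    length 𝓖                               ≡⟨ length-headIn+headOut 𝓖 ⟩
    length (headIn 𝓖) + length (headOut 𝓖) ≤⟨ +-mono-≤ (star-length≤C n x j (headIn-unique u) (headIn⁺ suc-injective sized) (headIn⁺ drop-there ∋x))
                                                        (star-length≤C n x (suc j) (headOut-unique u) (headOut⁺ id sized) (headOut⁺ drop-there ∋x)) ⟩
    n C j + n C suc j                       ≡⟨ nCk+nC[k+1]≡[n+1]C[k+1] n j ⟩
    suc n C suc j                           ∎
    where open ≤-Reasoning

  nCk>0 : ∀ {n k} → k ≤ n → n C k > 0
  nCk>0 {n}     {zero}  _         = s≤s z≤n
  nCk>0 {suc n} {suc k} (s≤s k≤n) = begin-strict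
    0                  <⟨ nCk>0 k≤n ⟩
    n C k              ≤⟨ m≤m+n (n C k) (n C suc k) ⟩
    n C k + n C suc k  ≡⟨ nCk+nC[k+1]≡[n+1]C[k+1] n k ⟩
    suc n C suc k      ∎
    where open ≤-Reasoning

  [m+2]*mCj≤[j+2]*[m+1]C[j+1] : ∀ m j → (2 + m) * (m C j) ≤ (2 + j) * (suc m C suc j)
  [m+2]*mCj≤[j+2]*[m+1]C[j+1] zero    zero    = ≤-refl
  [m+2]*mCj≤[j+2]*[m+1]C[j+1] zero    (suc j) = z≤n
  [m+2]*mCj≤[j+2]*[m+1]C[j+1] (suc m) zero    rewrite nC1≡n (2 + m) = begin
    (3 + m) * 1       ≡⟨ *-identityʳ (3 + m) ⟩
    3 + m             ≤⟨ m≤m+n (3 + m) (1 + m) ⟩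
    3 + m + (1 + m)   ≡⟨ double m ⟩
    2 * (2 + m)       ∎
    where
    open ≤-Reasoning
    double : ∀ m → 3 + m + (1 + m) ≡ 2 * (2 + m)
    double = solve-∀
  [m+2]*mCj≤[j+2]*[m+1]C[j+1] (suc m) (suc j) = begin
    (3 + m) * U                           ≡⟨ cong ((3 + m) *_) X+Y≡U ⟨
    (3 + m) * (X + Y)                     ≡⟨ expand m X Y ⟩
    (2 + m) * X + (2 + m) * Y + (X + Y)   ≤⟨ +-monoˡ-≤ (X + Y) (+-mono-≤ ([m+2]*mCj≤[j+2]*[m+1]C[j+1] m j) ([m+2]*mCj≤[j+2]*[m+1]C[j+1] m (suc j))) ⟩
    (2 + j) * U + (3 + j) * V + (X + Y)   ≡⟨ cong ((2 + j) * U + (3 + j) * V +_) X+Y≡U ⟩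
    (2 + j) * U + (3 + j) * V + U         ≡⟨ collect j U V ⟩
    (3 + j) * (U + V)                     ≡⟨ cong ((3 + j) *_) (nCk+nC[k+1]≡[n+1]C[k+1] (suc m) (suc j)) ⟩
    (3 + j) * ((2 + m) C (2 + j))         ∎
    where
    open ≤-Reasoning
    X Y U V : ℕ
    X = m C j
    Y = m C suc j
    U = suc m C suc j
    V = suc m C (2 + j)
    X+Y≡U : X + Y ≡ U
    X+Y≡U = nCk+nC[k+1]≡[n+1]C[k+1] m j
    expand : ∀ m x y → (3 + m) * (x + y) ≡ (2 + m) * x + (2 + m) * y + (x + y)
    expand = solve-∀
    collect : ∀ j u v → (2 + j) * u + (3 + j) * v + u ≡ (3 + j) * (u + v)
    collect = solve-∀

  -- For k = 1 the truncated k ∸ 2 makes the binomial inequality false; there M = 0 instead.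
  k*M*[n*[n-2]C[k-2]]≤M*[k*k]*[n-1]C[k-1] : ∀ n k M → 2 ≤ n → 1 ≤ k → (k ≡ 1 → M ≡ 0) →
    k * M * (n * ((n ∸ 2) C (k ∸ 2))) ≤ M * (k * k) * ((n ∸ 1) C (k ∸ 1))
  k*M*[n*[n-2]C[k-2]]≤M*[k*k]*[n-1]C[k-1] n              1               M _ _ M≡0 rewrite M≡0 refl = z≤n
  k*M*[n*[n-2]C[k-2]]≤M*[k*k]*[n-1]C[k-1] 1              (suc (suc j))   M (s≤s ()) _ _
  k*M*[n*[n-2]C[k-2]]≤M*[k*k]*[n-1]C[k-1] (suc (suc m)) k@(suc (suc j)) M _ _ _ = begin
    k * M * ((2 + m) * (m C j))      ≤⟨ *-monoʳ-≤ (k * M) ([m+2]*mCj≤[j+2]*[m+1]C[j+1] m j) ⟩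
    k * M * (k * (suc m C suc j))    ≡⟨ rearrange k M (suc m C suc j) ⟩
    M * (k * k) * (suc m C suc j)    ∎
    where
    open ≤-Reasoning
    rearrange : ∀ k m b → k * m * (k * b) ≡ m * (k * k) * b
    rearrange = solve-∀

  maxLinkSize : Family n → ℕ → ℕ
  maxLinkSize {n} 𝓕 i = maxℕ (map (linkSize 𝓕) (subsetsOfSize n i))

  maxLinkSize₂≡0 : ∀ {𝓕 : Family n} → All (λ F → ∣ F ∣ ≡ 1) 𝓕 → maxLinkSize 𝓕 2 ≡ 0
  maxLinkSize₂≡0 {n} {𝓕} sized = n≤0⇒n≡0 (maxℕ-lub (linkSize 𝓕) (subsetsOfSize n 2) λ {P} P∈ →
    ≤-reflexive (cong length (filter-none (P ⊆?_) (All.map (P⊈F P∈) sized))))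
    where
    P⊈F : ∀ {P F} → P ∈ₗ subsetsOfSize n 2 → ∣ F ∣ ≡ 1 → ¬ P ⊆ F
    P⊈F P∈ ∣F∣≡1 P⊆F with subst₂ _≤_ (∈-subsetsOfSize⁻ P∈) ∣F∣≡1 (p⊆q⇒∣p∣≤∣q∣ P⊆F)
    ... | s≤s ()

  maxLinkSize₁>0 : ∀ {k} {𝓕 : Family n} → All (λ F → ∣ F ∣ ≡ suc k) 𝓕 → 0 < length 𝓕 → 0 < maxLinkSize 𝓕 1
  maxLinkSize₁>0 {n} {𝓕 = 𝓕@(F ∷ _)} (∣F∣≡1+k ∷ _) _ with y , y∈F ← 0<∣p∣⇒∃∈ F (subst (0 <_) (sym ∣F∣≡1+k) (s≤s z≤n)) =
    ≤-trans (filter-some (⁅ y ⁆ ⊆?_) (here (x∈p⇒⁅x⁆⊆p y∈F)))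
            (maxℕ-bound (linkSize 𝓕) {⁅ y ⁆} (subsetsOfSize n 1) (∈-subsetsOfSize⁺ (∣⁅x⁆∣≡1 y)))

  maxLinkSize₁-attained : ∀ (𝓕 : Family n) → 0 < maxLinkSize 𝓕 1 → ∃[ x ] linkSize 𝓕 ⁅ x ⁆ ≡ maxLinkSize 𝓕 1
  maxLinkSize₁-attained {n} 𝓕 M₁>0
    with P , P∈ , linkP≡M₁ ← maxℕ-attained (linkSize 𝓕) (subsetsOfSize n 1) M₁>0
    with x , refl ← ∣p∣≡1⇒p≡⁅x⁆ P (∈-subsetsOfSize⁻ P∈)
    = x , linkP≡M₁

  length>0⇒∃∈ : ∀ {xs : List T} → 0 < length xs → ∃[ x ] x ∈ₗ xs
  length>0⇒∃∈ {xs = x ∷ _} _ = x , here refl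

  module VertexStar {n k} (𝓕 : Family (suc n)) (unique : Unique 𝓕) (sized : All (λ F → ∣ F ∣ ≡ suc k) 𝓕)
                    (x : Fin (suc n)) (x-maximal : linkSize 𝓕 ⁅ x ⁆ ≡ maxLinkSize 𝓕 1) where

    𝓕ₓ 𝓕ₓᶜ : Family (suc n)
    𝓕ₓ  = filter (⁅ x ⁆ ⊆?_) 𝓕
    𝓕ₓᶜ = filter (∁? (⁅ x ⁆ ⊆?_)) 𝓕

    private
      M₁ M₂ : ℕ
      M₁ = maxLinkSize 𝓕 1
      M₂ = maxLinkSize 𝓕 2

    ∈𝓕ₓᶜ⁻ : ∀ {A} → A ∈ₗ 𝓕ₓᶜ → A ∈ₗ 𝓕 × x ∉ A
    ∈𝓕ₓᶜ⁻ A∈ with A∈𝓕 , ⁅x⁆⊈A ← ∈-filter⁻ (∁? (⁅ x ⁆ ⊆?_)) {xs = 𝓕} A∈ = A∈𝓕 , ⁅x⁆⊈A ∘ x∈p⇒⁅x⁆⊆p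

    degree-𝓕ₓ≤M₂ : ∀ {A y} → x ∉ A → y ∈ A → degree y 𝓕ₓ ≤ M₂
    degree-𝓕ₓ≤M₂ {y = y} x∉A y∈A = ≤-trans
      (length-filter-filter≤ (⁅ x ⁆ ⊆?_) (y ∈?_) ((⁅ x ⁆ ∪ ⁅ y ⁆) ⊆?_) (λ ⁅x⁆⊆G → ⁅x⁆∪⁅y⁆⊆p (⁅x⁆⊆G (x∈⁅x⁆ x))) 𝓕)
      (maxℕ-bound (linkSize 𝓕) {⁅ x ⁆ ∪ ⁅ y ⁆} (subsetsOfSize _ 2) (∈-subsetsOfSize⁺ (∣⁅x⁆∪⁅y⁆∣≡2 x≢y)))
      where
      x≢y : x ≢ y
      x≢y refl = x∉A y∈A

    overlapSum-𝓕ₓ≤kM₂ : ∀ {A} → A ∈ₗ 𝓕 → x ∉ A → overlapSum A 𝓕ₓ ≤ suc k * M₂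
    overlapSum-𝓕ₓ≤kM₂ {A} A∈𝓕 x∉A =
      subst (λ s → overlapSum A 𝓕ₓ ≤ s * M₂) (All.lookup sized A∈𝓕) (overlapSum≤∣p∣*maxDegree A 𝓕ₓ (degree-𝓕ₓ≤M₂ x∉A))

    length≤d+overlapSum : ∀ {A} → A ∈ₗ 𝓕 → ∀ {P : Pred (Subset (suc n)) 0ℓ} (P? : Decidable P) →
      length (filter P? 𝓕) ≤ d 𝓕 + overlapSum A (filter P? 𝓕)
    length≤d+overlapSum {A} A∈𝓕 P? = ≤-trans (length≤disjointCount+overlapSum A (filter P? 𝓕))
      (+-monoˡ-≤ _ (≤-trans (length-filter-filter≤ P? disjoint? disjoint? (λ _ → id) 𝓕) (maxℕ-bound (disjointCount 𝓕) 𝓕 A∈𝓕)))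
      where
      disjoint? : Decidable (λ G → Disjoint A G)
      disjoint? G = ¬? (nonempty? (A ∩ G))

    M₁+|𝓕ₓᶜ|≡|𝓕| : M₁ + length 𝓕ₓᶜ ≡ length 𝓕
    M₁+|𝓕ₓᶜ|≡|𝓕| = trans (cong (_+ length 𝓕ₓᶜ) (sym x-maximal)) (length-filter+length-filter-∁ (⁅ x ⁆ ⊆?_) 𝓕)

    M₁≤nCk : M₁ ≤ n C k
    M₁≤nCk = subst (_≤ n C k) x-maximal (star-length≤C n x k (Unique.filter⁺ _ unique) (All.filter⁺ _ sized)
      (All.map (λ ⁅x⁆⊆F → ⁅x⁆⊆F (x∈⁅x⁆ x)) (All.all-filter (⁅ x ⁆ ⊆?_) 𝓕)))

    |𝓕ₓᶜ|>0 : n C k < length 𝓕 → 0 < length 𝓕ₓᶜ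
    |𝓕ₓᶜ|>0 big = +-cancelˡ-< M₁ 0 (length 𝓕ₓᶜ) (begin-strict
      M₁ + 0             ≡⟨ +-identityʳ M₁ ⟩
      M₁                 ≤⟨ M₁≤nCk ⟩
      n C k              <⟨ big ⟩
      length 𝓕           ≡⟨ M₁+|𝓕ₓᶜ|≡|𝓕| ⟨
      M₁ + length 𝓕ₓᶜ    ∎)
      where open ≤-Reasoning

    M₁≤d+kM₂ : n C k < length 𝓕 → M₁ ≤ d 𝓕 + suc k * M₂
    M₁≤d+kM₂ big with A , A∈𝓕ₓᶜ ← length>0⇒∃∈ (|𝓕ₓᶜ|>0 big) with A∈𝓕 , x∉A ← ∈𝓕ₓᶜ⁻ A∈𝓕ₓᶜ =
      subst (_≤ d 𝓕 + suc k * M₂) x-maximal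
        (≤-trans (length≤d+overlapSum A∈𝓕 (⁅ x ⁆ ⊆?_)) (+-monoʳ-≤ (d 𝓕) (overlapSum-𝓕ₓ≤kM₂ A∈𝓕 x∉A)))

    M₁*|𝓕ₓᶜ|≤M₁*d+|𝓕ₓᶜ|*kM₂ : M₁ * length 𝓕ₓᶜ ≤ M₁ * d 𝓕 + length 𝓕ₓᶜ * (suc k * M₂)
    M₁*|𝓕ₓᶜ|≤M₁*d+|𝓕ₓᶜ|*kM₂ = begin
      M₁ * b                                                       ≡⟨ cong (_* b) x-maximal ⟨
      length 𝓕ₓ * b                                                ≡⟨ sum-map-const b 𝓕ₓ ⟨
      sum (map (λ _ → b) 𝓕ₓ)                                       ≤⟨ sum-map-mono 𝓕ₓ (λ A∈ → length≤d+overlapSum (𝓕ₓ⊆𝓕 A∈) _) ⟩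
      sum (map (λ A → d 𝓕 + overlapSum A 𝓕ₓᶜ) 𝓕ₓ)                  ≡⟨ sum-map-+ (λ _ → d 𝓕) (λ A → overlapSum A 𝓕ₓᶜ) 𝓕ₓ ⟩
      sum (map (λ _ → d 𝓕) 𝓕ₓ) + sum (map (λ A → overlapSum A 𝓕ₓᶜ) 𝓕ₓ)
        ≡⟨ cong₂ _+_ (trans (sum-map-const (d 𝓕) 𝓕ₓ) (cong (_* d 𝓕) x-maximal)) (sum-map-swap (λ A G → ∣ A ∩ G ∣) 𝓕ₓ 𝓕ₓᶜ) ⟩
      M₁ * d 𝓕 + sum (map (λ G → sum (map (λ A → ∣ A ∩ G ∣) 𝓕ₓ)) 𝓕ₓᶜ) ≤⟨ +-monoʳ-≤ (M₁ * d 𝓕) (sum-map-mono 𝓕ₓᶜ ∑∣A∩G∣≤kM₂) ⟩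
      M₁ * d 𝓕 + sum (map (λ _ → suc k * M₂) 𝓕ₓᶜ)                 ≡⟨ cong (M₁ * d 𝓕 +_) (sum-map-const (suc k * M₂) 𝓕ₓᶜ) ⟩
      M₁ * d 𝓕 + b * (suc k * M₂)                                   ∎
      where
      open ≤-Reasoning
      b : ℕ
      b = length 𝓕ₓᶜ
      𝓕ₓ⊆𝓕 : ∀ {A} → A ∈ₗ 𝓕ₓ → A ∈ₗ 𝓕
      𝓕ₓ⊆𝓕 A∈ = proj₁ (∈-filter⁻ (⁅ x ⁆ ⊆?_) {xs = 𝓕} A∈)
      ∑∣A∩G∣≤kM₂ : ∀ {G} → G ∈ₗ 𝓕ₓᶜ → sum (map (λ A → ∣ A ∩ G ∣) 𝓕ₓ) ≤ suc k * M₂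
      ∑∣A∩G∣≤kM₂ {G} G∈ with G∈𝓕 , x∉G ← ∈𝓕ₓᶜ⁻ G∈ = begin
        sum (map (λ A → ∣ A ∩ G ∣) 𝓕ₓ) ≡⟨ cong sum (map-cong (λ A → cong ∣_∣ (∩-comm A G)) 𝓕ₓ) ⟩
        overlapSum G 𝓕ₓ               ≤⟨ overlapSum-𝓕ₓ≤kM₂ G∈𝓕 x∉G ⟩
        suc k * M₂                    ∎

open import Defs
open import Data.Nat using (ℕ; zero; suc; _∸_; _≤_; _<_; z≤n; s≤s; s≤s⁻¹; >-nonZero) renaming (_*_ to _*ℕ_)
open import Data.Nat.Properties using (≤-trans; <⇒≤; m≤m+n; *-monoʳ-≤; ∸-monoˡ-≤)
open import Data.Nat.Combinatorics using (_C_)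
open import Data.Rational using (ℚ; ½; 1ℚ; _⊔_; _-_; _*_) renaming (_≤_ to _≤ℚ_)
open import Data.List using (length)
open import Data.Product using (_,_)
open import Data.List.Relation.Unary.All using (All)
open import Data.List.Relation.Unary.Unique.Propositional using (Unique)
open import Data.Fin.Subset using (∣_∣)
open import Relation.Binary.PropositionalEquality using (_≡_; refl)

open Arithmetic using (bound-from-counts)
open Counting using (maxLinkSize; maxLinkSize₁>0; maxLinkSize₁-attained; maxLinkSize₂≡0; nCk>0;
                     k*M*[n*[n-2]C[k-2]]≤M*[k*k]*[n-1]C[k-1]; module VertexStar)

corollary2 : (n k : ℕ) → 2 *ℕ k ≤ n → 1 < 2 *ℕ k →
    (𝓕 : Family n) → Unique 𝓕 → All (λ F → ∣ F ∣ ≡ k) 𝓕 →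
    (n ∸ 1) C (k ∸ 1) < length 𝓕 →
    (½ ⊔ (1ℚ - c n k 1 𝓕))
      * (1ℚ - ((c n k 2 𝓕 * ℕtoℚ (k *ℕ k)) ÷' (c n k 1 𝓕 * ℕtoℚ n)))
      * ℕtoℚ (length 𝓕)
      ≤ℚ ℕtoℚ (d 𝓕)
corollary2 n       zero    _    ()
corollary2 zero    (suc k) ()
corollary2 (suc n) (suc k) 2k≤n _ 𝓕 unique sized big
  with M₁>0 ← maxLinkSize₁>0 sized (≤-trans (s≤s z≤n) big)
  with x , x-maximal ← maxLinkSize₁-attained 𝓕 M₁>0 =
  let open VertexStar 𝓕 unique sized x x-maximal in
  bound-from-counts (suc n) (suc k) {{_}} {{>-nonZero M₁>0}} {{>-nonZero (nCk>0 k≤n)}} {{>-nonZero (nCk>0 (∸-monoˡ-≤ 1 k≤n))}}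
    M₁+|𝓕ₓᶜ|≡|𝓕| (<⇒≤ big) (M₁≤d+kM₂ big) M₁*|𝓕ₓᶜ|≤M₁*d+|𝓕ₓᶜ|*kM₂
    (k*M*[n*[n-2]C[k-2]]≤M*[k*k]*[n-1]C[k-1] (suc n) (suc k) (maxLinkSize 𝓕 2) 2≤n (s≤s z≤n) λ { refl → maxLinkSize₂≡0 sized })
  where
  1+k≤1+n : suc k ≤ suc n
  1+k≤1+n = ≤-trans (m≤m+n (suc k) _) 2k≤n
  k≤n : k ≤ n
  k≤n = s≤s⁻¹ 1+k≤1+n
  2≤n : 2 ≤ suc n
  2≤n = ≤-trans (*-monoʳ-≤ 2 (s≤s z≤n)) 2k≤n
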